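{- Let $b,\phi,c,\delta\in(0,1)$ with $c\le1/2$, $\phi\le b$, $b\le c$ and $\delta\le c^2b/\log n$. Let $G=(V,E)$ be an $n$-vertex graph, fix a cluster $U\subseteq V$, and let $H=(V,E',w)$ be a weighted subgraph of $G$ with $H[U]\approx_\delta G[U]$. Then: (1) every cut $\emptyset\ne S\subsetneq U$ that is not $b/2$-boundary-linked in $U$ satisfies $\Phi^\circ_U(S)<\phi$; and (2) every cut $S\subseteq U$ that is $b/2$-boundary-linked in $U$ satisfies $(1-\frac c{\log n})|E(S,U\setminus S)|\le w(S,U\setminus S)\le(1+\frac c{\log n})|E(S,U\setminus S)|$.
   Context: $\log$ is base 2. $E(A,B)$ is the set of edges of $G$ between $A$ and $B$ and $\mathrm{vol}(S)$ the sum of degrees in $G$; $w(A,B)$ is the total weight of edges of $H$ between $A$ and $B$. $H[U]\approx_\delta G[U]$ means: for all $S\subseteq U$, $\big|w(S,U\setminus S)-|E(S,U\setminus S)|\big|\le\delta|E(S,V\setminus S)|$, and for all $S\subseteq V$, $(1-\delta)|E(S,V\setminus S)|\le w(S,V\setminus S)\le(1+\delta)|E(S,V\setminus S)|$. For $S\subseteq U$: $\mathrm{vol}^\circ_U(S)=\mathrm{vol}(S)+(\frac b\phi-1)|E(S,V\setminus U)|$ (the volume of $S$ in the graph $G[U]$ with a self-loop of weight $\frac b\phi|E(\{u\},V\setminus U)|$ added at each $u\in U$), and for $\emptyset\ne S\subsetneq U$, $\Phi^\circ_U(S)=|E(S,U\setminus S)|/\min\{\mathrm{vol}^\circ_U(S),\mathrm{vol}^\circ_U(U\setminus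 S)\}$. For $\beta\in(0,1)$, a cut $S\subseteq U$ is $\beta$-boundary-linked in $U$ if $|E(S,U\setminus S)|\ge\beta\min\{|E(S,V\setminus S)|,|E(U\setminus S,V\setminus(U\setminus S))|\}$.
   Formalization: The parameters b, φ, c, δ range over the rationals in (0,1), and the edge weights of H are rational. -}

module Defs where

open import Data.Bool using (Bool; true; false; if_then_else_; _∧_; not)
open import Data.Fin using (Fin)
open import Data.List using (List; foldr; map; allFin)
open import Data.Nat as ℕ using (ℕ; _^_)
open import Data.Integer as ℤ using (ℤ; +_; -[1+_])
open import Data.Rational as ℚ
  using (ℚ; 0ℚ; 1ℚ; _+_; _*_; _-_; _÷_; _⊓_; _≤_; _<_; ↥_; ↧ₙ_; ≢-nonZero)
open import Data.Product using (Σ; _×_)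
open import Relation.Nullary using (yes; no)
open import Relation.Binary.PropositionalEquality using (_≡_)

record Graph (n : ℕ) : Set where
  field
    adj     : Fin n → Fin n → Bool
    symm    : ∀ i j → adj i j ≡ adj j i
    irrefl  : ∀ i → adj i i ≡ false
open Graph public

-- A weighted subgraph H = (V, E', w) of G: a symmetric nonnegative
-- weight function whose support (the edge set E') is contained in E(G).
record WeightedSubgraph {n : ℕ} (G : Graph n) : Set where
  field
    wt      : Fin n → Fin n → ℚ
    wsymm   : ∀ i j → wt i j ≡ wt j i
    wnonneg : ∀ i j → 0ℚ ≤ wt i j
    wsub    : ∀ i j → adj G i j ≡ false → wt i j ≡ 0ℚ
open WeightedSubgraph public

VSet : ℕ → Set
VSet n = Fin n → Bool

full : ∀ {n} → VSet n
full _ = true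

_∖_ : ∀ {n} → VSet n → VSet n → VSet n
(A ∖ B) i = A i ∧ not (B i)

_⊆_ : ∀ {n} → VSet n → VSet n → Set
A ⊆ B = ∀ i → A i ≡ true → B i ≡ true

NonemptyProper : ∀ {n} → VSet n → VSet n → Set
NonemptyProper {n} S U =
  (S ⊆ U) × Σ (Fin n) (λ i → S i ≡ true) × Σ (Fin n) (λ i → (U ∖ S) i ≡ true)

ΣV : ∀ {n} → (Fin n → ℚ) → ℚ
ΣV {n} f = foldr _+_ 0ℚ (map f (allFin n))

𝟙 : Bool → ℚ
𝟙 b = if b then 1ℚ else 0ℚ

-- |E(A,B)| : number of ordered pairs (a,b) ∈ A × B that are edges of G
-- (for disjoint A, B this is the number of edges between A and B).
E : ∀ {n} → Graph n → VSet n → VSet n → ℚ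
E G A B = ΣV (λ i → ΣV (λ j → 𝟙 (A i ∧ B j ∧ adj G i j)))

w : ∀ {n} {G : Graph n} → WeightedSubgraph G → VSet n → VSet n → ℚ
w H A B = ΣV (λ i → ΣV (λ j → 𝟙 (A i ∧ B j) * wt H i j))

deg : ∀ {n} → Graph n → Fin n → ℚ
deg G i = ΣV (λ j → 𝟙 (adj G i j))

vol : ∀ {n} → Graph n → VSet n → ℚ
vol G S = ΣV (λ i → 𝟙 (S i) * deg G i)

-- Total division (x/0 := 0); only used where the denominator is positive
-- anyway.
_÷₀_ : ℚ → ℚ → ℚ
x ÷₀ y with y ℚ.≟ 0ℚ
... | yes _  = 0ℚ
... | no y≢0 = _÷_ x y {{≢-nonZero y≢0}}

-- vol°_U(S) = vol(S) + (b/φ - 1)|E(S, V∖U)|   (φ > 0 in all uses)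
vol° : ∀ {n} → Graph n → (b φ : ℚ) → VSet n → VSet n → ℚ
vol° G b φ U S = vol G S + ((b ÷₀ φ) - 1ℚ) * E G S (full ∖ U)

Φ° : ∀ {n} → Graph n → (b φ : ℚ) → VSet n → VSet n → ℚ
Φ° G b φ U S = E G S (U ∖ S) ÷₀ (vol° G b φ U S ⊓ vol° G b φ U (U ∖ S))

BoundaryLinked : ∀ {n} → Graph n → ℚ → VSet n → VSet n → Set
BoundaryLinked G β U S =
  β * (E G S (full ∖ S) ⊓ E G (U ∖ S) (full ∖ (U ∖ S))) ≤ E G S (U ∖ S)

Approx : ∀ {n} {G : Graph n} → WeightedSubgraph G → ℚ → VSet n → Set
Approx {n} {G} H δ U =
  (∀ (S : VSet n) → S ⊆ U →
     ℚ.∣ w H S (U ∖ S) - E G S (U ∖ S) ∣ ≤ δ * E G S (full ∖ S))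
  × (∀ (S : VSet n) →
     ((1ℚ - δ) * E G S (full ∖ S) ≤ w H S (full ∖ S))
     × (w H S (full ∖ S) ≤ (1ℚ + δ) * E G S (full ∖ S)))

-- Exact comparison  a · log₂ n ≤ r  for rationals a, r (no reals needed).
-- Writing a = p₁/q₁, r = p₂/q₂ (q's positive), a·log₂ n ≤ r iff
-- n^(p₁q₂) ≤ 2^(p₂q₁) (integer exponents), cleared of negative exponents.

posPart : ℤ → ℕ
posPart (+ k)    = k
posPart -[1+ _ ] = 0

negPart : ℤ → ℕ
negPart (+ _)    = 0
negPart -[1+ k ] = ℕ.suc k

MulLog₂≤ : ℕ → ℚ → ℚ → Set
MulLog₂≤ n a r =
  let e₁ = (↥ a) ℤ.* (+ (↧ₙ r))
      e₂ = (↥ r) ℤ.* (+ (↧ₙ a))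
  in  (n ^ posPart e₁) ℕ.* (2 ^ negPart e₂) ℕ.≤ (n ^ negPart e₁) ℕ.* (2 ^ posPart e₂)

{-# OPTIONS --safe #-}
-- Write e = |E(S,U∖S)| and ∂T = |E(T,V∖U)| for T ∈ {S, U∖S}, so that |E(T,V∖T)| = e + ∂T.
-- (1) If S is not b/2-boundary-linked, then e < (b/2)(e + ∂T) for both T, hence e < b·∂T as b ≤ 1;
-- and φ·vol°_U(T) = φ·vol(T) + (b − φ)·∂T ≥ b·∂T because ∂T ≤ vol(T).  So e < φ·min vol°_U.
-- (2) Applying H[U] ≈_δ G[U] to S and to U∖S gives |w(S,U∖S) − e| ≤ δ·m with m = min |E(T,V∖T)|,
-- and boundary-linkedness gives (b/2)·m ≤ e; so |w − e|·log n ≤ m·c²b ≤ 2c²·e ≤ c·e.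
-- MulLog₂≤ n a r compares powers of n and 2 with cross-multiplied exponents; it is invariant under
-- scaling both exponents by k > 0 (k-th roots are monotone), which makes it monotone in a and r
-- and stable under multiplying a and r by t ≥ 0.
module Submission where

open import Defs
open import Data.Nat as ℕ using (ℕ)
open import Data.Rational as ℚ using (ℚ; 0ℚ; 1ℚ; ½; _+_; _*_; _-_; _≤_; _<_)
open import Data.Product using (_×_)
open import Relation.Nullary using (¬_)

open import Data.Bool using (true; false; _∧_; not)
import Data.Bool.Properties as BoolP
open import Data.Empty using (⊥-elim)
open import Data.Fin using (Fin)
open import Data.Integer as ℤ using (ℤ; +_; -[1+_])
import Data.Integer.Properties as ℤP
import Data.Integer.Solver as ℤSolver
open import Data.List using (List; []; _∷_; foldr; map; allFin)
open import Data.Nat using (zero; suc; _^_; NonZero; z≤n; s≤s)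
import Data.Nat.Properties as ℕP
import Data.Nat.Solver as ℕSolver
open import Data.Product using (_,_)
open import Data.Rational using (mkℚ; ↥_; ↧_; ↧ₙ_; -_; _⊓_; 1/_; ∣_∣)
import Data.Rational.Properties as ℚP
open import Data.Rational.Solver using (module +-*-Solver)
open import Data.Sum using (inj₁; inj₂)
open import Function using (_∘_)
open import Relation.Nullary using (yes; no)
open import Relation.Binary.PropositionalEquality

^-distrib-* : ∀ x y k → (x ℕ.* y) ^ k ≡ x ^ k ℕ.* y ^ k
^-distrib-* x y zero    = refl
^-distrib-* x y (suc k) rewrite ^-distrib-* x y k =
  solve 4 (λ x y u v → (x :* y) :* (u :* v) := (x :* u) :* (y :* v)) refl x y (x ^ k) (y ^ k)
  where open ℕSolver.+-*-Solver

^-*-^-merge : ∀ x y a b c d → (x ^ a ℕ.* y ^ b) ℕ.* (x ^ c ℕ.* y ^ d) ≡ x ^ (a ℕ.+ c) ℕ.* y ^ (b ℕ.+ d)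
^-*-^-merge x y a b c d rewrite ℕP.^-distribˡ-+-* x a c | ℕP.^-distribˡ-+-* y b d =
  solve 4 (λ u v w z → (u :* v) :* (w :* z) := (u :* w) :* (v :* z)) refl (x ^ a) (y ^ b) (x ^ c) (y ^ d)
  where open ℕSolver.+-*-Solver

posPart-*ʳ : ∀ e k → posPart (e ℤ.* + k) ≡ posPart e ℕ.* k
posPart-*ʳ (+ a)    k rewrite sym (ℤP.pos-* a k) = refl
posPart-*ʳ -[1+ a ] zero rewrite ℤP.*-zeroʳ -[1+ a ] = refl
posPart-*ʳ -[1+ a ] (suc k) = refl

negPart-*ʳ : ∀ e k → negPart (e ℤ.* + k) ≡ negPart e ℕ.* k
negPart-*ʳ (+ a)    k rewrite sym (ℤP.pos-* a k) = refl
negPart-*ʳ -[1+ a ] zero rewrite ℤP.*-zeroʳ -[1+ a ] = sym (ℕP.*-zeroʳ (suc a))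
negPart-*ʳ -[1+ a ] (suc k) = refl

posPart+negPart-mono : ∀ {e e'} → e' ℤ.≤ e → posPart e' ℕ.+ negPart e ℕ.≤ posPart e ℕ.+ negPart e'
posPart+negPart-mono ℤ.-≤+         = z≤n
posPart+negPart-mono (ℤ.-≤- n≤m)   = s≤s n≤m
posPart+negPart-mono (ℤ.+≤+ m≤n)   = ℕP.+-monoˡ-≤ 0 m≤n

*-cross : ∀ {a b g x y : ℤ} → a ℤ.* g ≡ x → b ℤ.* g ≡ y → a ℤ.* y ≡ x ℤ.* b
*-cross {a} {b} {g} refl refl = solve 3 (λ a b g → a :* (b :* g) := (a :* g) :* b) refl a b g
  where open ℤSolver.+-*-Solver

↥*↧-cross : ∀ p q → ↥ (p * q) ℤ.* + (↧ₙ p ℕ.* ↧ₙ q) ≡ (↥ p ℤ.* ↥ q) ℤ.* ↧ (p * q)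
↥*↧-cross p q = *-cross {↥ (p * q)} {↧ (p * q)} (ℚP.↥-* p q) (trans (ℚP.↧-* p q) (sym (ℤP.pos-* (↧ₙ p) (↧ₙ q))))

module MulLog₂ (n : ℕ) .{{_ : NonZero n}} where

  -- Pow≤ A B C D encodes (A − B)·log₂ n ≤ C − D.
  Pow≤ : ℕ → ℕ → ℕ → ℕ → Set
  Pow≤ A B C D = n ^ A ℕ.* 2 ^ D ℕ.≤ n ^ B ℕ.* 2 ^ C

  Pow≤-mono : ∀ {A B C D A' B' C' D'} → A' ℕ.+ B ℕ.≤ A ℕ.+ B' → C ℕ.+ D' ℕ.≤ C' ℕ.+ D
    → Pow≤ A B C D → Pow≤ A' B' C' D'
  Pow≤-mono {A} {B} {C} {D} {A'} {B'} {C'} {D'} A'+B≤A+B' C+D'≤C'+D AD≤BC =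
    ℕP.*-cancelʳ-≤ (n ^ A' ℕ.* 2 ^ D') (n ^ B' ℕ.* 2 ^ C') (n ^ B ℕ.* 2 ^ D)
      {{ℕP.m*n≢0 (n ^ B) (2 ^ D) {{ℕP.m^n≢0 n B}} {{ℕP.m^n≢0 2 D}}}} (begin
      (n ^ A' ℕ.* 2 ^ D') ℕ.* (n ^ B ℕ.* 2 ^ D)    ≡⟨ ^-*-^-merge n 2 A' D' B D ⟩
      n ^ (A' ℕ.+ B) ℕ.* 2 ^ (D' ℕ.+ D)            ≤⟨ ℕP.*-monoˡ-≤ (2 ^ (D' ℕ.+ D)) (ℕP.^-monoʳ-≤ n A'+B≤A+B') ⟩
      n ^ (A ℕ.+ B') ℕ.* 2 ^ (D' ℕ.+ D)            ≡⟨ cong (λ x → n ^ (A ℕ.+ B') ℕ.* 2 ^ x) (ℕP.+-comm D' D) ⟩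
      n ^ (A ℕ.+ B') ℕ.* 2 ^ (D ℕ.+ D')            ≡⟨ ^-*-^-merge n 2 A D B' D' ⟨
      (n ^ A ℕ.* 2 ^ D) ℕ.* (n ^ B' ℕ.* 2 ^ D')    ≤⟨ ℕP.*-monoˡ-≤ (n ^ B' ℕ.* 2 ^ D') AD≤BC ⟩
      (n ^ B ℕ.* 2 ^ C) ℕ.* (n ^ B' ℕ.* 2 ^ D')    ≡⟨ ^-*-^-merge n 2 B C B' D' ⟩
      n ^ (B ℕ.+ B') ℕ.* 2 ^ (C ℕ.+ D')            ≤⟨ ℕP.*-monoʳ-≤ (n ^ (B ℕ.+ B')) (ℕP.^-monoʳ-≤ 2 C+D'≤C'+D) ⟩
      n ^ (B ℕ.+ B') ℕ.* 2 ^ (C' ℕ.+ D)            ≡⟨ cong (λ x → n ^ x ℕ.* 2 ^ (C' ℕ.+ D)) (ℕP.+-comm B B') ⟩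
      n ^ (B' ℕ.+ B) ℕ.* 2 ^ (C' ℕ.+ D)            ≡⟨ ^-*-^-merge n 2 B' C' B D ⟨
      (n ^ B' ℕ.* 2 ^ C') ℕ.* (n ^ B ℕ.* 2 ^ D)    ∎)
    where open ℕP.≤-Reasoning

  ^-Pow : ∀ A D k → (n ^ A ℕ.* 2 ^ D) ^ k ≡ n ^ (A ℕ.* k) ℕ.* 2 ^ (D ℕ.* k)
  ^-Pow A D k rewrite ^-distrib-* (n ^ A) (2 ^ D) k | ℕP.^-*-assoc n A k | ℕP.^-*-assoc 2 D k = refl

  Pow≤-^ : ∀ {A B C D} k → Pow≤ A B C D → Pow≤ (A ℕ.* k) (B ℕ.* k) (C ℕ.* k) (D ℕ.* k)
  Pow≤-^ {A} {B} {C} {D} k AD≤BC = subst₂ ℕ._≤_ (^-Pow A D k) (^-Pow B C k) (ℕP.^-monoˡ-≤ k AD≤BC)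

  Pow≤-^⁻¹ : ∀ {A B C D} k .{{_ : NonZero k}} → Pow≤ (A ℕ.* k) (B ℕ.* k) (C ℕ.* k) (D ℕ.* k) → Pow≤ A B C D
  Pow≤-^⁻¹ {A} {B} {C} {D} k AD≤BCᵏ with n ^ A ℕ.* 2 ^ D ℕ.≤? n ^ B ℕ.* 2 ^ C
  ... | yes AD≤BC = AD≤BC
  ... | no  AD≰BC = ⊥-elim (ℕP.<⇒≱ BCᵏ<ADᵏ AD≤BCᵏ)
    where
    BCᵏ<ADᵏ : n ^ (B ℕ.* k) ℕ.* 2 ^ (C ℕ.* k) ℕ.< n ^ (A ℕ.* k) ℕ.* 2 ^ (D ℕ.* k)
    BCᵏ<ADᵏ = subst₂ ℕ._<_ (^-Pow B C k) (^-Pow A D k) (ℕP.^-monoˡ-< k (ℕP.≰⇒> AD≰BC))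

  IntLog≤ : ℤ → ℤ → Set
  IntLog≤ e₁ e₂ = Pow≤ (posPart e₁) (negPart e₁) (posPart e₂) (negPart e₂)

  IntLog≤-mono : ∀ {e₁ e₂ e₁' e₂'} → e₁' ℤ.≤ e₁ → e₂ ℤ.≤ e₂' → IntLog≤ e₁ e₂ → IntLog≤ e₁' e₂'
  IntLog≤-mono {e₁} {e₂} {e₁'} {e₂'} e₁'≤e₁ e₂≤e₂' =
    Pow≤-mono {posPart e₁} {negPart e₁} {posPart e₂} {negPart e₂}
              {posPart e₁'} {negPart e₁'} {posPart e₂'} {negPart e₂'}
      (posPart+negPart-mono e₁'≤e₁) (posPart+negPart-mono e₂≤e₂')

  IntLog≤-*ʳ : ∀ {e₁ e₂} k → IntLog≤ e₁ e₂ → IntLog≤ (e₁ ℤ.* + k) (e₂ ℤ.* + k)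
  IntLog≤-*ʳ {e₁} {e₂} k
    rewrite posPart-*ʳ e₁ k | negPart-*ʳ e₁ k | posPart-*ʳ e₂ k | negPart-*ʳ e₂ k =
    Pow≤-^ {posPart e₁} {negPart e₁} {posPart e₂} {negPart e₂} k

  IntLog≤-*ʳ⁻¹ : ∀ {e₁ e₂} k .{{_ : NonZero k}} → IntLog≤ (e₁ ℤ.* + k) (e₂ ℤ.* + k) → IntLog≤ e₁ e₂
  IntLog≤-*ʳ⁻¹ {e₁} {e₂} k
    rewrite posPart-*ʳ e₁ k | negPart-*ʳ e₁ k | posPart-*ʳ e₂ k | negPart-*ʳ e₂ k =
    Pow≤-^⁻¹ {posPart e₁} {negPart e₁} {posPart e₂} {negPart e₂} k

  -- FracLog≤ pa qa pr qr encodes (pa/qa)·log₂ n ≤ pr/qr; MulLog₂≤ n a r is FracLog≤ (↥ a) (↧ₙ a) (↥ r) (↧ₙ r).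
  FracLog≤ : ℤ → ℕ → ℤ → ℕ → Set
  FracLog≤ pa qa pr qr = IntLog≤ (pa ℤ.* + qr) (pr ℤ.* + qa)

  FracLog≤-mono : ∀ {pa qa pr qr pa' qa' pr' qr'} .{{_ : NonZero qa}} .{{_ : NonZero qr}}
    → pa' ℤ.* + qa ℤ.≤ pa ℤ.* + qa' → pr ℤ.* + qr' ℤ.≤ pr' ℤ.* + qr
    → FracLog≤ pa qa pr qr → FracLog≤ pa' qa' pr' qr'
  FracLog≤-mono {pa} {qa} {pr} {qr} {pa'} {qa'} {pr'} {qr'} a'≤a r≤r' =
    IntLog≤-*ʳ⁻¹ {pa' ℤ.* + qr'} {pr' ℤ.* + qa'} qa ∘
    IntLog≤-*ʳ⁻¹ {pa' ℤ.* + qr' ℤ.* + qa} {pr' ℤ.* + qa' ℤ.* + qa} qr ∘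
    IntLog≤-mono lhs rhs ∘
    IntLog≤-*ʳ {pa ℤ.* + qr ℤ.* + qa'} {pr ℤ.* + qa ℤ.* + qa'} qr' ∘
    IntLog≤-*ʳ {pa ℤ.* + qr} {pr ℤ.* + qa} qa'
    where
    open ℤSolver.+-*-Solver
    *-monoʳ-≤-pos² : ∀ {x y} k l → x ℤ.≤ y → x ℤ.* + k ℤ.* + l ℤ.≤ y ℤ.* + k ℤ.* + l
    *-monoʳ-≤-pos² k l = ℤP.*-monoʳ-≤-nonNeg (+ l) ∘ ℤP.*-monoʳ-≤-nonNeg (+ k)
    lhs : pa' ℤ.* + qr' ℤ.* + qa ℤ.* + qr ℤ.≤ pa ℤ.* + qr ℤ.* + qa' ℤ.* + qr'
    lhs = subst₂ ℤ._≤_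
      (solve 4 (λ p q r s → p :* q :* r :* s := p :* s :* q :* r) refl pa' (+ qa) (+ qr) (+ qr'))
      (solve 4 (λ p q r s → p :* q :* r :* s := p :* r :* q :* s) refl pa (+ qa') (+ qr) (+ qr'))
      (*-monoʳ-≤-pos² qr qr' a'≤a)
    rhs : pr ℤ.* + qa ℤ.* + qa' ℤ.* + qr' ℤ.≤ pr' ℤ.* + qa' ℤ.* + qa ℤ.* + qr
    rhs = subst₂ ℤ._≤_
      (solve 4 (λ p q r s → p :* q :* r :* s := p :* r :* s :* q) refl pr (+ qr') (+ qa) (+ qa'))
      (solve 4 (λ p q r s → p :* q :* r :* s := p :* s :* r :* q) refl pr' (+ qr) (+ qa) (+ qa'))
      (*-monoʳ-≤-pos² qa qa' r≤r')

  FracLog≤-scale : ∀ {pa qa pr qr} k d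
    → FracLog≤ pa qa pr qr → FracLog≤ (+ k ℤ.* pa) (d ℕ.* qa) (+ k ℤ.* pr) (d ℕ.* qr)
  FracLog≤-scale {pa} {qa} {pr} {qr} k d =
    subst₂ IntLog≤ (reassoc pa qr) (reassoc pr qa) ∘
    IntLog≤-*ʳ {pa ℤ.* + qr ℤ.* + k} {pr ℤ.* + qa ℤ.* + k} d ∘
    IntLog≤-*ʳ {pa ℤ.* + qr} {pr ℤ.* + qa} k
    where
    open ℤSolver.+-*-Solver
    reassoc : ∀ p q → p ℤ.* + q ℤ.* + k ℤ.* + d ≡ + k ℤ.* p ℤ.* + (d ℕ.* q)
    reassoc p q = trans (solve 4 (λ p q k d → p :* q :* k :* d := k :* p :* (d :* q)) refl p (+ q) (+ k) (+ d))
                        (cong (+ k ℤ.* p ℤ.*_) (sym (ℤP.pos-* d q)))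

  mulLog₂≤-mono : ∀ {a r a' r'} → a' ≤ a → r ≤ r' → MulLog₂≤ n a r → MulLog₂≤ n a' r'
  mulLog₂≤-mono {a} {r} {a'} {r'} (ℚ.*≤* a'≤a) (ℚ.*≤* r≤r') =
    FracLog≤-mono {↥ a} {↧ₙ a} {↥ r} {↧ₙ r} {↥ a'} {↧ₙ a'} {↥ r'} {↧ₙ r'} a'≤a r≤r'

  mulLog₂≤-*ˡ : ∀ t {a r} → 0ℚ ≤ t → MulLog₂≤ n a r → MulLog₂≤ n (t * a) (t * r)
  mulLog₂≤-*ˡ t@(mkℚ (+ k) _ _) {a} {r} _ =
    FracLog≤-mono {+ k ℤ.* ↥ a} {↧ₙ t ℕ.* ↧ₙ a} {+ k ℤ.* ↥ r} {↧ₙ t ℕ.* ↧ₙ r}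
                  {↥ (t * a)} {↧ₙ (t * a)} {↥ (t * r)} {↧ₙ (t * r)}
      (ℤP.≤-reflexive (↥*↧-cross t a)) (ℤP.≤-reflexive (sym (↥*↧-cross t r))) ∘
    FracLog≤-scale {↥ a} {↧ₙ a} {↥ r} {↧ₙ r} k (↧ₙ t)
  mulLog₂≤-*ˡ (mkℚ -[1+ _ ] _ _) (ℚ.*≤* ())

*-÷₀-cancel : ∀ x {y} → 0ℚ < y → y * (x ÷₀ y) ≡ x
*-÷₀-cancel x {y} 0<y with y ℚP.≟ 0ℚ
... | yes y≡0 = ⊥-elim (ℚP.<-irrefl (sym y≡0) 0<y)
... | no  y≢0 = begin
  y * (x * 1/ y)   ≡⟨ solve 3 (λ y x z → y :* (x :* z) := x :* (y :* z)) refl y x (1/ y) ⟩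
  x * (y * 1/ y)   ≡⟨ cong (x *_) (ℚP.*-inverseʳ y) ⟩
  x * 1ℚ           ≡⟨ ℚP.*-identityʳ x ⟩
  x                ∎
  where
  open ≡-Reasoning
  open +-*-Solver
  instance _ = ℚ.≢-nonZero y≢0

÷₀-< : ∀ {x y z} → 0ℚ < y → x < z * y → x ÷₀ y < z
÷₀-< {x} {y} {z} 0<y x<zy with y ℚP.≟ 0ℚ
... | yes y≡0 = ⊥-elim (ℚP.<-irrefl (sym y≡0) 0<y)
... | no  y≢0 = ℚP.*-cancelʳ-<-nonNeg y {{ℚ.nonNegative (ℚP.<⇒≤ 0<y)}} (begin-strict
  x * 1/ y * y      ≡⟨ ℚP.*-assoc x (1/ y) y ⟩
  x * (1/ y * y)    ≡⟨ cong (x *_) (ℚP.*-inverseˡ y) ⟩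
  x * 1ℚ            ≡⟨ ℚP.*-identityʳ x ⟩
  x                 <⟨ x<zy ⟩
  z * y             ∎)
  where
  open ℚP.≤-Reasoning
  instance _ = ℚ.≢-nonZero y≢0

<-⊓ : ∀ {x y z} → x < y → x < z → x < y ⊓ z
<-⊓ {x} {y} {z} x<y x<z with ℚP.⊓-sel y z
... | inj₁ y⊓z≡y = subst (x <_) (sym y⊓z≡y) x<y
... | inj₂ y⊓z≡z = subst (x <_) (sym y⊓z≡z) x<z

+-cancelˡ-< : ∀ x {y z} → x + y < x + z → y < z
+-cancelˡ-< x {y} {z} x+y<x+z = subst₂ _<_ (cancel y) (cancel z) (ℚP.+-monoʳ-< (- x) x+y<x+z)
  where
  cancel : ∀ u → - x + (x + u) ≡ u
  cancel = solve 2 (λ x u → :- x :+ (x :+ u) := u) refl x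
    where open +-*-Solver

p≤∣p∣ : ∀ p → p ≤ ∣ p ∣
p≤∣p∣ p with ℚP.≤-total 0ℚ p
... | inj₁ 0≤p = ℚP.≤-reflexive (sym (ℚP.0≤p⇒∣p∣≡p 0≤p))
... | inj₂ p≤0 = ℚP.≤-trans p≤0 (ℚP.0≤∣p∣ p)

-p≤∣p∣ : ∀ p → - p ≤ ∣ p ∣
-p≤∣p∣ p = subst (- p ≤_) (ℚP.∣-p∣≡∣p∣ p) (p≤∣p∣ (- p))

<-half-sum⇒< : ∀ {b e β} → b ≤ 1ℚ → 0ℚ ≤ e → e < b * ½ * (e + β) → e < b * β
<-half-sum⇒< {b} {e} {β} b≤1 0≤e e<b½[e+β] = +-cancelˡ-< e (begin-strict
  e + e                                 <⟨ ℚP.+-mono-< e<b½[e+β] e<b½[e+β] ⟩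
  b * ½ * (e + β) + b * ½ * (e + β)     ≡⟨ halves ⟩
  b * e + b * β                         ≤⟨ ℚP.+-monoˡ-≤ (b * β) b*e≤e ⟩
  e + b * β                             ∎)
  where
  open ℚP.≤-Reasoning
  open +-*-Solver
  halves : b * ½ * (e + β) + b * ½ * (e + β) ≡ b * e + b * β
  halves = solve 3 (λ b e β → b :* con ½ :* (e :+ β) :+ b :* con ½ :* (e :+ β) := b :* e :+ b :* β) refl b e β
  b*e≤e : b * e ≤ e
  b*e≤e = ℚP.≤-trans (ℚP.*-monoʳ-≤-nonNeg e {{ℚ.nonNegative 0≤e}} b≤1) (ℚP.≤-reflexive (ℚP.*-identityˡ e))

∑ : {A : Set} → List A → (A → ℚ) → ℚ
∑ xs f = foldr _+_ 0ℚ (map f xs)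

module _ {A : Set} where

  ∑-cong : ∀ (xs : List A) {f g : A → ℚ} → (∀ i → f i ≡ g i) → ∑ xs f ≡ ∑ xs g
  ∑-cong []       f≗g = refl
  ∑-cong (x ∷ xs) f≗g = cong₂ _+_ (f≗g x) (∑-cong xs f≗g)

  ∑-mono : ∀ (xs : List A) {f g : A → ℚ} → (∀ i → f i ≤ g i) → ∑ xs f ≤ ∑ xs g
  ∑-mono []       f≤g = ℚP.≤-refl
  ∑-mono (x ∷ xs) f≤g = ℚP.+-mono-≤ (f≤g x) (∑-mono xs f≤g)

  ∑-zero : ∀ (xs : List A) → ∑ xs (λ _ → 0ℚ) ≡ 0ℚ
  ∑-zero []       = refl
  ∑-zero (x ∷ xs) = trans (ℚP.+-identityˡ _) (∑-zero xs)

  ∑-distrib-+ : ∀ (xs : List A) (f g : A → ℚ) → ∑ xs (λ i → f i + g i) ≡ ∑ xs f + ∑ xs g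
  ∑-distrib-+ []       f g = refl
  ∑-distrib-+ (x ∷ xs) f g rewrite ∑-distrib-+ xs f g =
    solve 4 (λ a b c d → (a :+ b) :+ (c :+ d) := (a :+ c) :+ (b :+ d)) refl (f x) (g x) (∑ xs f) (∑ xs g)
    where open +-*-Solver

  ∑-distribˡ-* : ∀ (xs : List A) c (f : A → ℚ) → ∑ xs (λ i → c * f i) ≡ c * ∑ xs f
  ∑-distribˡ-* []       c f = sym (ℚP.*-zeroʳ c)
  ∑-distribˡ-* (x ∷ xs) c f rewrite ∑-distribˡ-* xs c f = sym (ℚP.*-distribˡ-+ c (f x) (∑ xs f))

∑-comm : ∀ {A B : Set} (xs : List A) (ys : List B) (f : A → B → ℚ)
  → ∑ xs (λ i → ∑ ys (f i)) ≡ ∑ ys (λ j → ∑ xs (λ i → f i j))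
∑-comm []       ys f = sym (∑-zero ys)
∑-comm (x ∷ xs) ys f rewrite ∑-comm xs ys f = sym (∑-distrib-+ ys (f x) (λ j → ∑ xs (λ i → f i j)))

0≤𝟙 : ∀ b → 0ℚ ≤ 𝟙 b
0≤𝟙 true  = ℚP.nonNegative⁻¹ 1ℚ
0≤𝟙 false = ℚP.≤-refl

𝟙-∧-≤ : ∀ x y a → 𝟙 (x ∧ y ∧ a) ≤ 𝟙 x * 𝟙 a
𝟙-∧-≤ false y     a = ℚP.≤-reflexive (sym (ℚP.*-zeroˡ (𝟙 a)))
𝟙-∧-≤ true  false a = ℚP.≤-trans (0≤𝟙 a) (ℚP.≤-reflexive (sym (ℚP.*-identityˡ (𝟙 a))))
𝟙-∧-≤ true  true  a = ℚP.≤-reflexive (sym (ℚP.*-identityˡ (𝟙 a)))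

𝟙-∖-split : ∀ {s u} x a → (s ≡ true → u ≡ true)
  → 𝟙 (x ∧ not s ∧ a) ≡ 𝟙 (x ∧ (u ∧ not s) ∧ a) + 𝟙 (x ∧ not u ∧ a)
𝟙-∖-split {s}     {u}     false a _   = refl
𝟙-∖-split {true}  {true}  true  a _   = refl
𝟙-∖-split {true}  {false} true  a s⇒u with () ← s⇒u refl
𝟙-∖-split {false} {true}  true  a _   = sym (ℚP.+-identityʳ (𝟙 a))
𝟙-∖-split {false} {false} true  a _   = sym (ℚP.+-identityˡ (𝟙 a))

∖-∖-⊆ : ∀ s u → (s ≡ true → u ≡ true) → u ∧ not (u ∧ not s) ≡ s
∖-∖-⊆ true  true  _   = refl
∖-∖-⊆ true  false s⇒u with () ← s⇒u refl
∖-∖-⊆ false true  _   = refl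
∖-∖-⊆ false false _   = refl

∑∑-cong : ∀ {n} {f g : Fin n → Fin n → ℚ} → (∀ i j → f i j ≡ g i j)
  → ΣV (λ i → ΣV (f i)) ≡ ΣV (λ i → ΣV (g i))
∑∑-cong {n} f≗g = ∑-cong (allFin n) (∑-cong (allFin n) ∘ f≗g)

∖-⊆ : ∀ {n} (U S : VSet n) → (U ∖ S) ⊆ U
∖-⊆ U S i with U i
... | true  = λ _ → refl
... | false = λ ()

module _ {n : ℕ} (G : Graph n) where

  private
    V = allFin n

  E-nonneg : ∀ A B → 0ℚ ≤ E G A B
  E-nonneg A B = subst (_≤ E G A B) (trans (∑-cong V (λ _ → ∑-zero V)) (∑-zero V))
    (∑-mono V (λ i → ∑-mono V (λ j → 0≤𝟙 _)))

  E-cong : ∀ {A A' B B'} → (∀ i → A i ≡ A' i) → (∀ j → B j ≡ B' j) → E G A B ≡ E G A' B'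
  E-cong A≗A' B≗B' = ∑∑-cong (λ i j → cong₂ (λ x y → 𝟙 (x ∧ y ∧ adj G i j)) (A≗A' i) (B≗B' j))

  E-comm : ∀ A B → E G A B ≡ E G B A
  E-comm A B = trans (∑-comm V V _) (∑∑-cong (λ j i → cong 𝟙 (begin
    A i ∧ B j ∧ adj G i j    ≡⟨ cong (λ z → A i ∧ B j ∧ z) (symm G i j) ⟩
    A i ∧ B j ∧ adj G j i    ≡⟨ BoolP.∧-assoc (A i) (B j) _ ⟨
    (A i ∧ B j) ∧ adj G j i  ≡⟨ cong (_∧ adj G j i) (BoolP.∧-comm (A i) (B j)) ⟩
    (B j ∧ A i) ∧ adj G j i  ≡⟨ BoolP.∧-assoc (B j) (A i) _ ⟩
    B j ∧ A i ∧ adj G j i    ∎)))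
    where open ≡-Reasoning

  E-split : ∀ S U → S ⊆ U → E G S (full ∖ S) ≡ E G S (U ∖ S) + E G S (full ∖ U)
  E-split S U S⊆U = trans (∑∑-cong (λ i j → 𝟙-∖-split (S i) (adj G i j) (S⊆U j)))
                          (trans (∑-cong V (λ i → ∑-distrib-+ V _ _)) (∑-distrib-+ V _ _))

  E≤vol : ∀ A B → E G A B ≤ vol G A
  E≤vol A B = subst (E G A B ≤_) (∑-cong V (λ i → ∑-distribˡ-* V (𝟙 (A i)) (λ j → 𝟙 (adj G i j))))
    (∑-mono V (λ i → ∑-mono V (λ j → 𝟙-∧-≤ (A i) (B j) (adj G i j))))

  E-cut-comm : ∀ S U → S ⊆ U → E G (U ∖ S) (U ∖ (U ∖ S)) ≡ E G S (U ∖ S)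
  E-cut-comm S U S⊆U = trans (E-comm (U ∖ S) _) (E-cong (λ i → ∖-∖-⊆ (S i) (U i) (S⊆U i)) (λ _ → refl))

  module _ (H : WeightedSubgraph G) where

    w-comm : ∀ A B → w H A B ≡ w H B A
    w-comm A B = trans (∑-comm V V _)
      (∑∑-cong (λ j i → cong₂ (λ x y → 𝟙 x * y) (BoolP.∧-comm (A i) (B j)) (wsymm H i j)))

    w-cut-comm : ∀ S U → S ⊆ U → w H (U ∖ S) (U ∖ (U ∖ S)) ≡ w H S (U ∖ S)
    w-cut-comm S U S⊆U = trans (w-comm (U ∖ S) _)
      (∑∑-cong (λ i j → cong (λ x → 𝟙 (x ∧ (U j ∧ not (S j))) * wt H i j) (∖-∖-⊆ (S i) (U i) (S⊆U i))))

b*boundary≤φ*vol° : ∀ {n} (G : Graph n) {b φ} U S → 0ℚ < φ → b * E G S (full ∖ U) ≤ φ * vol° G b φ U S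
b*boundary≤φ*vol° G {b} {φ} U S 0<φ = begin
  b * β                                    ≡⟨ solve 3 (λ b φ β → b :* β := φ :* β :+ (b :- φ) :* β) refl b φ β ⟩
  φ * β + (b - φ) * β                      ≤⟨ ℚP.+-monoˡ-≤ ((b - φ) * β) (ℚP.*-monoˡ-≤-nonNeg φ (E≤vol G S (full ∖ U))) ⟩
  φ * vol G S + (b - φ) * β                ≡⟨ cong (λ t → φ * vol G S + (t - φ) * β) (*-÷₀-cancel b 0<φ) ⟨
  φ * vol G S + (φ * (b ÷₀ φ) - φ) * β     ≡⟨ solve 4 (λ φ v z β → φ :* v :+ (φ :* z :- φ) :* β
                                                        := φ :* (v :+ (z :- con 1ℚ) :* β)) refl φ (vol G S) (b ÷₀ φ) β ⟩
  φ * vol° G b φ U S                       ∎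
  where
  open ℚP.≤-Reasoning
  open +-*-Solver
  instance _ = ℚ.nonNegative (ℚP.<⇒≤ 0<φ)
  β = E G S (full ∖ U)

cut<φ*vol° : ∀ {n} (G : Graph n) {b φ} U S → b ≤ 1ℚ → 0ℚ < φ → S ⊆ U
  → E G S (U ∖ S) < b * ½ * E G S (full ∖ S) → E G S (U ∖ S) < φ * vol° G b φ U S
cut<φ*vol° G {b} U S b≤1 0<φ S⊆U e<b½∂S = ℚP.<-≤-trans
  (<-half-sum⇒< b≤1 (E-nonneg G S (U ∖ S)) (subst (λ t → E G S (U ∖ S) < b * ½ * t) (E-split G S U S⊆U) e<b½∂S))
  (b*boundary≤φ*vol° G U S 0<φ)

¬linked⇒Φ°<φ : ∀ {n} (G : Graph n) {b φ} U S → 0ℚ ≤ b → b ≤ 1ℚ → 0ℚ < φ → S ⊆ U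
  → ¬ BoundaryLinked G (b * ½) U S → Φ° G b φ U S < φ
¬linked⇒Φ°<φ G {b} {φ} U S 0≤b b≤1 0<φ S⊆U ¬linked = ÷₀-< 0<min e<φ*min
  where
  instance
    _ = ℚ.nonNegative (ℚP.<⇒≤ 0<φ)
    _ = ℚP.nonNeg*nonNeg⇒nonNeg b {{ℚ.nonNegative 0≤b}} ½
  T = U ∖ S
  e = E G S T
  ∂S = E G S (full ∖ S)
  ∂T = E G T (full ∖ T)
  e<b½min : e < b * ½ * (∂S ⊓ ∂T)
  e<b½min = ℚP.≰⇒> ¬linked
  e<φ*vol°S : e < φ * vol° G b φ U S
  e<φ*vol°S = cut<φ*vol° G U S b≤1 0<φ S⊆U
    (ℚP.<-≤-trans e<b½min (ℚP.*-monoˡ-≤-nonNeg (b * ½) (ℚP.p⊓q≤p ∂S ∂T)))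
  e<φ*vol°T : e < φ * vol° G b φ U T
  e<φ*vol°T = subst (_< φ * vol° G b φ U T) (E-cut-comm G S U S⊆U) (cut<φ*vol° G U T b≤1 0<φ (∖-⊆ U S)
    (subst (_< b * ½ * ∂T) (sym (E-cut-comm G S U S⊆U))
      (ℚP.<-≤-trans e<b½min (ℚP.*-monoˡ-≤-nonNeg (b * ½) (ℚP.p⊓q≤q ∂S ∂T)))))
  e<φ*min : e < φ * (vol° G b φ U S ⊓ vol° G b φ U T)
  e<φ*min = subst (e <_) (sym (ℚP.*-distribˡ-⊓-nonNeg φ _ _)) (<-⊓ e<φ*vol°S e<φ*vol°T)
  0<min : 0ℚ < vol° G b φ U S ⊓ vol° G b φ U T
  0<min = ℚP.*-cancelˡ-<-nonNeg φ
    (ℚP.≤-<-trans (ℚP.≤-trans (ℚP.≤-reflexive (ℚP.*-zeroʳ φ)) (E-nonneg G S T)) e<φ*min)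

cut-error≤δ*min : ∀ {n} {G : Graph n} (H : WeightedSubgraph G) {δ} U S → 0ℚ ≤ δ → Approx H δ U → S ⊆ U
  → ∣ w H S (U ∖ S) - E G S (U ∖ S) ∣ ≤ δ * (E G S (full ∖ S) ⊓ E G (U ∖ S) (full ∖ (U ∖ S)))
cut-error≤δ*min {G = G} H {δ} U S 0≤δ (≈cut , _) S⊆U =
  subst (∣ w H S T - E G S T ∣ ≤_) (sym (ℚP.*-distribˡ-⊓-nonNeg δ {{ℚ.nonNegative 0≤δ}} ∂S ∂T))
    (ℚP.⊓-glb (≈cut S S⊆U) (subst₂ (λ x y → ∣ x - y ∣ ≤ δ * ∂T)
      (w-cut-comm G H S U S⊆U) (E-cut-comm G S U S⊆U) (≈cut T (∖-⊆ U S))))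
  where
  T = U ∖ S
  ∂S = E G S (full ∖ S)
  ∂T = E G T (full ∖ T)

mulLog₂≤-error-bound : ∀ n .{{_ : NonZero n}} {b c δ m e x} → 0ℚ ≤ c → c ≤ ½ → 0ℚ ≤ m → 0ℚ ≤ e
  → x ≤ δ * m → b * ½ * m ≤ e → MulLog₂≤ n δ (c * c * b) → MulLog₂≤ n x (c * e)
mulLog₂≤-error-bound n {b} {c} {δ} {m} {e} {x} 0≤c c≤½ 0≤m 0≤e x≤δm b½m≤e =
  mulLog₂≤-mono (ℚP.≤-trans x≤δm (ℚP.≤-reflexive (ℚP.*-comm δ m))) m*c²b≤c*e ∘ mulLog₂≤-*ˡ m 0≤m
  where
  open MulLog₂ n
  open +-*-Solver
  instance
    _ = ℚ.nonNegative 0≤c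
    _ = ℚ.nonNegative 0≤e
    _ = ℚP.nonNeg*nonNeg⇒nonNeg c e
    _ = ℚP.nonNeg*nonNeg⇒nonNeg c (c + c) {{ℚP.nonNeg+nonNeg⇒nonNeg c c}}
  m*c²b≤c*e : m * (c * c * b) ≤ c * e
  m*c²b≤c*e = begin
    m * (c * c * b)             ≡⟨ solve 3 (λ m c b → m :* (c :* c :* b) := (c :* (c :+ c)) :* (b :* con ½ :* m)) refl m c b ⟩
    c * (c + c) * (b * ½ * m)   ≤⟨ ℚP.*-monoˡ-≤-nonNeg (c * (c + c)) b½m≤e ⟩
    c * (c + c) * e             ≡⟨ solve 2 (λ c e → c :* (c :+ c) :* e := c :* e :* (c :+ c)) refl c e ⟩
    c * e * (c + c)             ≤⟨ ℚP.*-monoˡ-≤-nonNeg (c * e) (ℚP.+-mono-≤ c≤½ c≤½) ⟩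
    c * e * 1ℚ                  ≡⟨ ℚP.*-identityʳ (c * e) ⟩
    c * e                       ∎
    where open ℚP.≤-Reasoning

linked⇒cut-approx : ∀ {n} .{{_ : NonZero n}} {G : Graph n} (H : WeightedSubgraph G) {b c δ} U S
  → 0ℚ ≤ c → c ≤ ½ → 0ℚ ≤ δ → MulLog₂≤ n δ (c * c * b) → Approx H δ U → S ⊆ U
  → BoundaryLinked G (b * ½) U S
  → MulLog₂≤ n (E G S (U ∖ S) - w H S (U ∖ S)) (c * E G S (U ∖ S))
    × MulLog₂≤ n (w H S (U ∖ S) - E G S (U ∖ S)) (c * E G S (U ∖ S))
linked⇒cut-approx {n} {G = G} H {b} {c} {δ} U S 0≤c c≤½ 0≤δ δlog≤c²b approx S⊆U linked =
    bound (ℚP.≤-trans (ℚP.≤-reflexive (solve 2 (λ e w → e :- w := :- (w :- e)) refl e w′)) (-p≤∣p∣ (w′ - e)))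
  , bound (p≤∣p∣ (w′ - e))
  where
  open +-*-Solver
  e = E G S (U ∖ S)
  w′ = w H S (U ∖ S)
  0≤min : 0ℚ ≤ E G S (full ∖ S) ⊓ E G (U ∖ S) (full ∖ (U ∖ S))
  0≤min = ℚP.⊓-glb (E-nonneg G S (full ∖ S)) (E-nonneg G (U ∖ S) (full ∖ (U ∖ S)))
  bound : ∀ {x} → x ≤ ∣ w′ - e ∣ → MulLog₂≤ n x (c * e)
  bound x≤err = mulLog₂≤-error-bound n {b} {c} {δ} 0≤c c≤½ 0≤min (E-nonneg G S (U ∖ S))
    (ℚP.≤-trans x≤err (cut-error≤δ*min H U S 0≤δ approx S⊆U)) linked δlog≤c²b

lemma5p5 : (b φ c δ : ℚ)
    → 0ℚ < b → b < 1ℚ → 0ℚ < φ → φ < 1ℚ → 0ℚ < c → c < 1ℚ → 0ℚ < δ → δ < 1ℚ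
    → c ≤ ½ → φ ≤ b → b ≤ c
    → (n : ℕ) → 2 ℕ.≤ n
    → MulLog₂≤ n δ (c * c * b)
    → (G : Graph n) (U : VSet n) (H : WeightedSubgraph G)
    → Approx H δ U
    → (∀ (S : VSet n) → NonemptyProper S U → ¬ BoundaryLinked G (b * ½) U S
         → Φ° G b φ U S < φ)
      × (∀ (S : VSet n) → S ⊆ U → BoundaryLinked G (b * ½) U S
         → MulLog₂≤ n (E G S (U ∖ S) - w H S (U ∖ S)) (c * E G S (U ∖ S))
           × MulLog₂≤ n (w H S (U ∖ S) - E G S (U ∖ S)) (c * E G S (U ∖ S)))
lemma5p5 b φ c δ 0<b b<1 0<φ _ 0<c _ 0<δ _ c≤½ _ _ n 2≤n δlog≤c²b G U H approx =
    (λ S (S⊆U , _) → ¬linked⇒Φ°<φ G U S (ℚP.<⇒≤ 0<b) (ℚP.<⇒≤ b<1) 0<φ S⊆U)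
  , (λ S S⊆U → linked⇒cut-approx H U S (ℚP.<⇒≤ 0<c) c≤½ (ℚP.<⇒≤ 0<δ) δlog≤c²b approx S⊆U)
  where
  instance _ = ℕ.>-nonZero (ℕP.≤-trans (ℕP.n≤1+n 1) 2≤n)
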